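{- If $H$ is a connected graph on at least three vertices then $\operatorname{sat}(n,\mathfrak{R}(H))\geq \frac{n-1}{2}$.
   Context: An edge-coloured graph is a graph with a (not necessarily proper) colouring of its edges by colours from the set of natural numbers. A copy of $H$ is rainbow if all its edges receive distinct colours; $\mathfrak{R}(H)$ denotes the family of rainbow copies of $H$. An edge-coloured graph is $\mathfrak{R}(H)$-saturated if it contains no rainbow copy of $H$ but adding any non-edge in any colour creates a rainbow copy of $H$. $\operatorname{sat}(n,\mathfrak{R}(H))$ (the rainbow saturation number, with an infinite palette of colours) is the minimum number of edges of such a graph on $n$ vertices. -}

module Defs where

open import Data.Nat using (ℕ; zero; suc; _+_; _*_; _∸_; _≤_; _<?_)
open import Data.Fin using (Fin; toℕ; _≟_)
open import Data.Maybe using (Maybe; just; nothing; is-just)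
open import Data.Bool using (Bool; true; false; if_then_else_; _∧_)
open import Data.List using (List; map; allFin)
open import Data.Nat.ListAction using (sum)
open import Data.Product using (Σ; ∃; _×_; _,_)
open import Data.Sum using (_⊎_)
open import Relation.Nullary using (¬_; does)
open import Relation.Binary.PropositionalEquality using (_≡_; _≢_)
open import Function.Definitions using (Injective)

record SimpleGraph (k : ℕ) : Set₁ where
  field
    Adj    : Fin k → Fin k → Set
    sym    : ∀ {u v} → Adj u v → Adj v u
    irrefl : ∀ {u} → ¬ Adj u u
open SimpleGraph public

data Reach {k : ℕ} (H : SimpleGraph k) : Fin k → Fin k → Set where
  here : ∀ {u} → Reach H u u
  step : ∀ {u v w} → Adj H u v → Reach H v w → Reach H u w

Connected : ∀ {k} → SimpleGraph k → Set
Connected H = ∀ u v → Reach H u v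

-- An edge-coloured graph on Fin n: colour i j = just α means ij is an edge
-- of colour α ∈ ℕ; nothing means non-edge.  Symmetric, loopless.
Colouring : ℕ → Set
Colouring n = Fin n → Fin n → Maybe ℕ

record ColGraph (n : ℕ) : Set where
  field
    colour : Colouring n
    sym    : ∀ i j → colour i j ≡ colour j i
    loopless : ∀ i → colour i i ≡ nothing
open ColGraph public

record RainbowCopy {k n : ℕ} (H : SimpleGraph k) (c : Colouring n) : Set where
  field
    φ      : Fin k → Fin n
    inj    : Injective _≡_ _≡_ φ
    isEdge : ∀ u v → Adj H u v → Σ ℕ (λ α → c (φ u) (φ v) ≡ just α)
    distinct : ∀ u v u' v' → Adj H u v → Adj H u' v' →
               c (φ u) (φ v) ≡ c (φ u') (φ v') →
               (u ≡ u' × v ≡ v') ⊎ (u ≡ v' × v ≡ u')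

addEdge : ∀ {n} → Colouring n → Fin n → Fin n → ℕ → Colouring n
addEdge c x y α i j =
  if (does (i ≟ x) ∧ does (j ≟ y)) then just α else
  (if (does (i ≟ y) ∧ does (j ≟ x)) then just α else c i j)

Saturated : ∀ {k n} → SimpleGraph k → ColGraph n → Set
Saturated H G =
  ¬ RainbowCopy H (colour G) ×
  (∀ x y → x ≢ y → colour G x y ≡ nothing → (α : ℕ) →
     RainbowCopy H (addEdge (colour G) x y α))

numEdges : ∀ {n} → ColGraph n → ℕ
numEdges {n} G = sum (map (λ i → sum (map (λ j →
  if (does (toℕ i <? toℕ j) ∧ is-just (colour G i j)) then 1 else 0)
  (allFin n))) (allFin n))

-- The proof has a structural half and a counting half.
--  * Structure: G has at most one isolated vertex.  If x ≠ y were both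
--    isolated, adding xy (in any colour) yields a rainbow copy φ of H.  Every
--    edge of that copy is either the new edge xy or an old edge, and old edges
--    avoid the isolated vertices x, y; so "φ u ∈ {x, y}" is preserved along
--    edges of H and, H being connected, holds for all u or for none.  For all
--    u it contradicts injectivity of φ (H has ≥ 3 vertices, {x, y} only 2);
--    for none, φ is already a rainbow copy in G, contradicting saturation.
--  * Counting: the degrees of G sum to 2·e(G) (handshake lemma), and a sum of
--    n natural numbers of which all but at most one are ≥ 1 is ≥ n - 1.
module Submission where

open import Defs
open import Data.Nat using (ℕ; _≤_; _*_; _∸_)
open import Data.Nat using (zero; suc; _+_; _<?_; s≤s; z≤n; _≤?_)
open import Data.Nat.Properties as ℕ using (≤-trans; m≤m+n; m≤n+m; +-mono-≤)
open import Data.Nat.ListAction using (sum)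
open import Data.Fin as Fin using (Fin; toℕ; _≟_)
open import Data.Fin.Properties using (toℕ-injective; suc-injective; pigeonhole; <⇒≢)
open import Data.Maybe using (just; nothing; is-just)
open import Data.Bool using (if_then_else_; _∧_)
open import Data.List using (List; []; _∷_; map; allFin; tabulate)
open import Data.List.Properties using (map-tabulate; map-cong)
open import Data.List.Relation.Unary.Any using (here; there)
open import Data.List.Membership.Propositional using (_∈_)
open import Data.List.Membership.Propositional.Properties using (∈-allFin)
open import Data.Product using (∃₂; _×_; _,_; proj₁; proj₂)
open import Data.Sum using (_⊎_; inj₁; inj₂; [_,_])
open import Data.Empty using (⊥; ⊥-elim)
open import Function.Definitions using (Injective)
open import Relation.Nullary using (¬_; does; yes; no)
open import Relation.Nullary.Decidable using (dec-true)
open import Relation.Binary using (tri<; tri≈; tri>)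
open import Relation.Binary.PropositionalEquality
  using (_≡_; _≢_; refl; trans; cong; subst; module ≡-Reasoning) renaming (sym to ≡-sym)
open import Algebra.Properties.CommutativeSemigroup ℕ.+-commutativeSemigroup
  using (interchange)

sum-map-+ : ∀ {A : Set} (f g : A → ℕ) (xs : List A) →
            sum (map (λ x → f x + g x) xs) ≡ sum (map f xs) + sum (map g xs)
sum-map-+ f g [] = refl
sum-map-+ f g (x ∷ xs) rewrite sum-map-+ f g xs =
  interchange (f x) (g x) (sum (map f xs)) (sum (map g xs))

sum-map-0 : ∀ {A : Set} (xs : List A) → sum (map (λ _ → 0) xs) ≡ 0
sum-map-0 [] = refl
sum-map-0 (x ∷ xs) = sum-map-0 xs

sum-swap : ∀ {A B : Set} (f : A → B → ℕ) (xs : List A) (ys : List B) →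
           sum (map (λ x → sum (map (f x) ys)) xs)
             ≡ sum (map (λ y → sum (map (λ x → f x y) xs)) ys)
sum-swap f [] ys = ≡-sym (sum-map-0 ys)
sum-swap f (x ∷ xs) ys rewrite sum-swap f xs ys =
  ≡-sym (sum-map-+ (f x) (λ y → sum (map (λ x → f x y) xs)) ys)

term≤sum : ∀ {A : Set} (f : A → ℕ) {x : A} {xs : List A} → x ∈ xs → f x ≤ sum (map f xs)
term≤sum f {xs = y ∷ ys} (here refl) = m≤m+n (f y) _
term≤sum f {xs = y ∷ ys} (there p) = ≤-trans (term≤sum f p) (m≤n+m _ (f y))

sum-positive : ∀ n (h : Fin n → ℕ) → (∀ i → 1 ≤ h i) → n ≤ sum (tabulate h)
sum-positive zero h pos = z≤n
sum-positive (suc n) h pos =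
  +-mono-≤ (pos Fin.zero) (sum-positive n (λ i → h (Fin.suc i)) (λ i → pos (Fin.suc i)))

sum-positive-but-one : ∀ n (h : Fin n → ℕ) (P : Fin n → Set) →
                       (∀ i → 1 ≤ h i ⊎ P i) → (∀ i j → P i → P j → i ≡ j) →
                       n ∸ 1 ≤ sum (tabulate h)
sum-positive-but-one zero h P pos-or-P unique = z≤n
sum-positive-but-one (suc n) h P pos-or-P unique with pos-or-P Fin.zero
... | inj₁ pos₀ =
  ≤-trans (ℕ.m≤n+m∸n n 1)
    (+-mono-≤ pos₀ (sum-positive-but-one n (λ i → h (Fin.suc i)) (λ i → P (Fin.suc i))
                     (λ i → pos-or-P (Fin.suc i))
                     (λ i j Pi Pj → suc-injective (unique _ _ Pi Pj))))
... | inj₂ P₀ = ≤-trans (sum-positive n (λ i → h (Fin.suc i)) pos) (m≤n+m _ (h Fin.zero))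
  where
  pos : ∀ i → 1 ≤ h (Fin.suc i)
  pos i with pos-or-P (Fin.suc i)
  ... | inj₁ posᵢ = posᵢ
  ... | inj₂ Pᵢ with unique _ _ P₀ Pᵢ
  ... | ()

OnPair : ∀ {n} → Fin n → Fin n → Fin n → Set
OnPair x y v = v ≡ x ⊎ v ≡ y

injective-not-into-pair : ∀ {k n} → 3 ≤ k → (φ : Fin k → Fin n) → Injective _≡_ _≡_ φ →
                          ∀ x y → ¬ (∀ u → OnPair x y (φ u))
injective-not-into-pair {k} 3≤k φ inj x y into = collision (pigeonhole 3≤k side)
  where
  side : Fin k → Fin 2
  side u = [ (λ _ → Fin.zero) , (λ _ → Fin.suc Fin.zero) ] (into u)

  collision : ∃₂ (λ i j → i Fin.< j × side i ≡ side j) → ⊥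
  collision (i , j , i<j , same-side) with into i | into j | same-side
  ... | inj₁ φi≡x | inj₁ φj≡x | _ = <⇒≢ i<j (inj (trans φi≡x (≡-sym φj≡x)))
  ... | inj₂ φi≡y | inj₂ φj≡y | _ = <⇒≢ i<j (inj (trans φi≡y (≡-sym φj≡y)))

reach-transport : ∀ {k} {H : SimpleGraph k} (P : Fin k → Set) →
                  (∀ {u v} → Adj H u v → P u → P v) →
                  ∀ {u w} → Reach H u w → P u → P w
reach-transport P along here Pu = Pu
reach-transport P along (step a walk) Pu = reach-transport P along walk (along a Pu)

Isolated : ∀ {n} → ColGraph n → Fin n → Set
Isolated G i = ∀ j → colour G i j ≡ nothing

edge-not-isolatedˡ : ∀ {n} (G : ColGraph n) {i j β} → colour G i j ≡ just β → ¬ Isolated G i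
edge-not-isolatedˡ G {j = j} ij-edge iso with trans (≡-sym ij-edge) (iso j)
... | ()

edge-not-isolatedʳ : ∀ {n} (G : ColGraph n) {i j β} → colour G i j ≡ just β → ¬ Isolated G j
edge-not-isolatedʳ G ij-edge = edge-not-isolatedˡ G (trans (ColGraph.sym G _ _) ij-edge)

off-isolated-pair : ∀ {n} (G : ColGraph n) {x y v} → Isolated G x → Isolated G y →
                    ¬ Isolated G v → ¬ OnPair x y v
off-isolated-pair G iso-x iso-y not-iso (inj₁ refl) = not-iso iso-x
off-isolated-pair G iso-x iso-y not-iso (inj₂ refl) = not-iso iso-y

addEdge-edge-reversed : ∀ {n} (c : Colouring n) x y α i j {β} →
                        (if does (i ≟ y) ∧ does (j ≟ x) then just α else c i j) ≡ just β →
                        (OnPair x y i × OnPair x y j) ⊎ c i j ≡ just β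
addEdge-edge-reversed c x y α i j ij-edge with i ≟ y | j ≟ x
... | yes i≡y | yes j≡x = inj₁ (inj₂ i≡y , inj₁ j≡x)
... | yes _   | no _    = inj₂ ij-edge
... | no _    | _       = inj₂ ij-edge

addEdge-edge : ∀ {n} (c : Colouring n) x y α i j {β} → addEdge c x y α i j ≡ just β →
               (OnPair x y i × OnPair x y j) ⊎ c i j ≡ just β
addEdge-edge c x y α i j ij-edge with i ≟ x | j ≟ y
... | yes i≡x | yes j≡y = inj₁ (inj₁ i≡x , inj₂ j≡y)
... | yes _   | no _    = addEdge-edge-reversed c x y α i j ij-edge
... | no _    | _       = addEdge-edge-reversed c x y α i j ij-edge

addEdge-away : ∀ {n} (c : Colouring n) x y α i j → ¬ OnPair x y i →
               addEdge c x y α i j ≡ c i j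
addEdge-away c x y α i j off with i ≟ x | i ≟ y
... | yes i≡x | _       = ⊥-elim (off (inj₁ i≡x))
... | no _    | yes i≡y = ⊥-elim (off (inj₂ i≡y))
... | no _    | no _    = refl

restrict-copy : ∀ {k n} {H : SimpleGraph k} (c : Colouring n) x y α →
                (R : RainbowCopy H (addEdge c x y α)) →
                (∀ u → ¬ OnPair x y (RainbowCopy.φ R u)) → RainbowCopy H c
restrict-copy c x y α R off = record
  { φ        = φ
  ; inj      = inj
  ; isEdge   = λ u v uv → let (β , e) = isEdge u v uv in β , trans (≡-sym (away u v)) e
  ; distinct = λ u v u' v' uv u'v' e →
      distinct u v u' v' uv u'v' (trans (away u v) (trans e (≡-sym (away u' v'))))
  }
  where
  open RainbowCopy R
  away : ∀ u v → addEdge c x y α (φ u) (φ v) ≡ c (φ u) (φ v)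
  away u v = addEdge-away c x y α (φ u) (φ v) (off u)

module IsolatedPair {k n} (H : SimpleGraph k) (connected : Connected H) (3≤k : 3 ≤ k)
                    (G : ColGraph n) (saturated : Saturated H G)
                    (x y : Fin n) (iso-x : Isolated G x) (iso-y : Isolated G y) (x≢y : x ≢ y)
                    where

  copy : RainbowCopy H (addEdge (colour G) x y 0)
  copy = proj₂ saturated x y x≢y (iso-x y) 0

  open RainbowCopy copy

  Hits : Fin k → Set
  Hits u = OnPair x y (φ u)

  -- An edge of the copy is the new edge xy or an old edge, which avoids the
  -- isolated vertices x and y; either way its ends agree on Hits.
  edge-agrees : ∀ {u v} → Adj H u v → (Hits u × Hits v) ⊎ (¬ Hits u × ¬ Hits v)
  edge-agrees {u} {v} uv with isEdge u v uv
  ... | β , e with addEdge-edge (colour G) x y 0 (φ u) (φ v) e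
  ... | inj₁ both = inj₁ both
  ... | inj₂ old  = inj₂ ( off-isolated-pair G iso-x iso-y (edge-not-isolatedˡ G old)
                         , off-isolated-pair G iso-x iso-y (edge-not-isolatedʳ G old))

  hits-along : ∀ {u v} → Adj H u v → Hits u → Hits v
  hits-along uv hu with edge-agrees uv
  ... | inj₁ (_ , hv)  = hv
  ... | inj₂ (¬hu , _) = ⊥-elim (¬hu hu)

  misses-along : ∀ {u v} → Adj H u v → ¬ Hits u → ¬ Hits v
  misses-along uv ¬hu with edge-agrees uv
  ... | inj₁ (hu , _)  = ⊥-elim (¬hu hu)
  ... | inj₂ (_ , ¬hv) = ¬hv

  -- By connectivity Hits holds everywhere or nowhere; the first contradicts
  -- injectivity, the second the absence of rainbow copies in G.
  -- Any vertex of H, to which connectivity is applied.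
  root : Fin k
  root = Fin.fromℕ< (≤-trans (s≤s z≤n) 3≤k)

  impossible : ⊥
  impossible with φ root ≟ x | φ root ≟ y
  ... | yes φr≡x | _ = injective-not-into-pair 3≤k φ inj x y
                         (λ u → reach-transport Hits hits-along (connected root u) (inj₁ φr≡x))
  ... | no _ | yes φr≡y = injective-not-into-pair 3≤k φ inj x y
                         (λ u → reach-transport Hits hits-along (connected root u) (inj₂ φr≡y))
  ... | no φr≢x | no φr≢y = proj₁ saturated
        (restrict-copy (colour G) x y 0 copy
          (λ u → reach-transport (λ w → ¬ Hits w) misses-along (connected root u)
                   [ φr≢x , φr≢y ]))

isolated-unique : ∀ {k n} (H : SimpleGraph k) → Connected H → 3 ≤ k →
                  (G : ColGraph n) → Saturated H G →
                  ∀ x y → Isolated G x → Isolated G y → x ≡ y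
isolated-unique H connected 3≤k G saturated x y iso-x iso-y with x ≟ y
... | yes x≡y = x≡y
... | no x≢y  = ⊥-elim (IsolatedPair.impossible H connected 3≤k G saturated x y iso-x iso-y x≢y)

module Degrees {n : ℕ} (G : ColGraph n) where

  edgeIndicator : Fin n → Fin n → ℕ
  edgeIndicator i j = if (does (toℕ i <? toℕ j) ∧ is-just (colour G i j)) then 1 else 0

  -- degree i counts each neighbour j of i once, via whichever of ij, ji is ordered.
  degree : Fin n → ℕ
  degree i = sum (map (λ j → edgeIndicator i j + edgeIndicator j i) (allFin n))

  handshake : sum (tabulate degree) ≡ 2 * numEdges G
  handshake = begin
    sum (tabulate degree)
      ≡⟨ cong sum (≡-sym (map-tabulate (λ i → i) degree)) ⟩
    sum (map degree A)
      ≡⟨ cong sum (map-cong (λ i → sum-map-+ (E i) (λ j → E j i) A) A) ⟩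
    sum (map (λ i → sum (map (E i) A) + sum (map (λ j → E j i) A)) A)
      ≡⟨ sum-map-+ (λ i → sum (map (E i) A)) (λ i → sum (map (λ j → E j i) A)) A ⟩
    numEdges G + sum (map (λ i → sum (map (λ j → E j i) A)) A)
      ≡⟨ cong (numEdges G +_) (≡-sym (sum-swap E A A)) ⟩
    numEdges G + numEdges G
      ≡⟨ cong (numEdges G +_) (≡-sym (ℕ.+-identityʳ (numEdges G))) ⟩
    2 * numEdges G ∎
    where
    open ≡-Reasoning
    A = allFin n
    E = edgeIndicator

  -- Each edge at i contributes 1 to its degree (G is loopless, so j ≠ i).
  edge-counted : ∀ i j {β} → colour G i j ≡ just β → 1 ≤ edgeIndicator i j + edgeIndicator j i
  edge-counted i j {β} ij-edge with ℕ.<-cmp (toℕ i) (toℕ j)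
  ... | tri< i<j _ _ rewrite ij-edge | dec-true (toℕ i <? toℕ j) i<j = s≤s z≤n
  ... | tri> _ _ j<i rewrite trans (ColGraph.sym G j i) ij-edge | dec-true (toℕ j <? toℕ i) j<i
    = m≤n+m 1 (edgeIndicator i j)
  ... | tri≈ _ i≡j _ with toℕ-injective i≡j
  ... | refl with trans (≡-sym ij-edge) (loopless G i)
  ... | ()

  degree-or-isolated : ∀ i → 1 ≤ degree i ⊎ Isolated G i
  degree-or-isolated i with 1 ≤? degree i
  ... | yes positive = inj₁ positive
  ... | no ¬positive = inj₂ no-edge
    where
    no-edge : ∀ j → colour G i j ≡ nothing
    no-edge j with colour G i j in ij-edge
    ... | nothing = refl
    ... | just β  = ⊥-elim (¬positive (≤-trans (edge-counted i j ij-edge)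
                      (term≤sum (λ j → edgeIndicator i j + edgeIndicator j i) (∈-allFin j))))

lemma2p1 : ∀ {k} (H : SimpleGraph k) → Connected H → 3 ≤ k →
           ∀ (n : ℕ) (G : ColGraph n) → Saturated H G →
           n ∸ 1 ≤ 2 * numEdges G
lemma2p1 H connected 3≤k n G saturated =
  subst (n ∸ 1 ≤_) handshake
    (sum-positive-but-one n degree (Isolated G) degree-or-isolated
      (isolated-unique H connected 3≤k G saturated))
  where
  open Degrees G
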